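{- Every $(96,19,2,4)$ partial difference set in a group of order $96$ is regular. That is, it satisfies $T=T^{(-1)}$ and does not contain the identity.
   Context: Let $G$ be a group of order $v$. A $(v,k,\lambda,\mu)$ partial difference set is a subset $T\subseteq G$ with $|T|=k$ such that the multiset $\{xy^{ -1}: x,y\in T,\ x\neq y\}$ contains each nonidentity element of $T$ exactly $\lambda$ times and each nonidentity element of $G\setminus T$ exactly $\mu$ times. Here $T^{(-1)}=\{t^{ -1}:t\in T\}$. $T$ is reversible if $T=T^{(-1)}$, and a reversible partial difference set is regular if $1_G\notin T$. -}

module Defs where

open import Data.Nat using (ℕ)
open import Data.Fin using (Fin; _≟_)
open import Data.Fin.Subset using (Subset; _∈_; _∉_; ∣_∣)
open import Data.Fin.Subset.Properties using (_∈?_)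
open import Data.List using (List; length; filter; allFin; cartesianProduct)
open import Data.Product using (_×_; _,_)
open import Relation.Nullary using (¬_; Dec; yes; no)
open import Relation.Nullary.Decidable using (_×-dec_; ¬?)
open import Relation.Binary.PropositionalEquality using (_≡_)
open import Algebra.Core using (Op₁; Op₂)
open import Function.Bundles using (_⇔_)

-- A group of order v is represented (up to isomorphism) by a group structure
-- on the carrier Fin v with propositional equality.

module _ {v : ℕ} (_∙_ : Op₂ (Fin v)) (ε : Fin v) (_⁻¹ : Op₁ (Fin v)) where

  diffPair? : (T : Subset v) (g : Fin v) (p : Fin v × Fin v) →
              Dec (let (x , y) = p in
                   (x ∈ T) × (y ∈ T) × (¬ x ≡ y) × ((x ∙ (y ⁻¹)) ≡ g))
  diffPair? T g (x , y) =
    (x ∈? T) ×-dec (y ∈? T) ×-dec ¬? (x ≟ y) ×-dec ((x ∙ (y ⁻¹)) ≟ g)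

  diffCount : Subset v → Fin v → ℕ
  diffCount T g =
    length (filter (diffPair? T g) (cartesianProduct (allFin v) (allFin v)))

  IsPDS : ℕ → ℕ → ℕ → Subset v → Set
  IsPDS k lam mu T =
    (∣ T ∣ ≡ k)
    × (∀ g → ¬ g ≡ ε → g ∈ T → diffCount T g ≡ lam)
    × (∀ g → ¬ g ≡ ε → g ∉ T → diffCount T g ≡ mu)

  Reversible : Subset v → Set
  Reversible T = ∀ x → (x ∈ T) ⇔ ((x ⁻¹) ∈ T)

  Regular : Subset v → Set
  Regular T = Reversible T × (ε ∉ T)

-- Let Δ(g) be the number of ways to write g = x y⁻¹ with x ≠ y in T. Swapping x and y
-- shows Δ(g⁻¹) = Δ(g); as λ ≠ μ, this forces g⁻¹ ∈ T whenever g ∈ T. Counting the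
-- ordered pairs of distinct elements of T by their quotient gives ∑_g Δ(g) = k(k − 1),
-- while Δ(ε) = 0 and Δ(g) + (μ − λ)[g ∈ T] = μ for g ≠ ε. Summing over the group,
-- k(k − 1) + (μ − λ)k = μ(v − 1) + (μ − λ)[ε ∈ T]; for (96, 19, 2, 4) both sides
-- without the last term equal 380, so ε ∉ T.
module Submission where

open import Defs
open import Data.Fin using (Fin)
open import Data.Fin.Subset using (Subset)
open import Relation.Binary.PropositionalEquality using (_≡_)
open import Algebra.Core using (Op₁; Op₂)
open import Algebra.Structures using (IsGroup)

open import Level using (Level)
open import Algebra.Bundles using (Group)
open import Data.Bool.Base using (if_then_else_; true; false)
open import Data.Fin.Base using (zero; suc; punchIn)
open import Data.Fin.Properties using (_≟_; punchInᵢ≢i)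
open import Data.Fin.Subset using (_∈_; _∉_; ∣_∣; inside; outside)
open import Data.Fin.Subset.Properties using (_∈?_)
open import Data.List.Base using (length; filter; tabulate; cartesianProduct; _++_) renaming (map to mapᴸ)
open import Data.List.Properties using (filter-++; length-++; map-tabulate)
open import Data.Nat.Base using (ℕ; zero; suc; _+_; _*_)
open import Data.Nat.Properties using (+-*-semiring; +-assoc; +-identityʳ;
  *-identityʳ; *-zeroʳ; *-comm; *-distribˡ-+)
open import Data.Nat.Tactic.RingSolver using (solve-∀)
open import Algebra.Properties.Semiring.Sum +-*-semiring using (sum; sum-syntax;
  sum-cong-≗; sum-replicate-zero; sum-remove; ∑-comm; ∑-distrib-+; *-distribˡ-sum)
open import Data.Product.Base using (_×_; _,_)
open import Data.Vec.Base using ([]; _∷_)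
open import Function.Base using (_∘_; id)
open import Function.Bundles using (mk⇔)
open import Relation.Binary.PropositionalEquality using (_≢_; refl; sym; trans; cong; cong₂; subst; module ≡-Reasoning)
open import Relation.Nullary using (¬_; Dec; yes; no; does; contradiction)
open import Relation.Nullary.Decidable using (¬?)
open import Relation.Unary using (Pred; Decidable)
import Algebra.Properties.Group as GroupProperties

private
  variable
    a p : Level
    A B : Set a

𝟙 : Dec A → ℕ
𝟙 a? = if does a? then 1 else 0

𝟙-yes : (a? : Dec A) → A → 𝟙 a? ≡ 1
𝟙-yes (yes _) _ = refl
𝟙-yes (no ¬a) a = contradiction a ¬a

𝟙-no : (a? : Dec A) → ¬ A → 𝟙 a? ≡ 0
𝟙-no (yes a) ¬a = contradiction a ¬a
𝟙-no (no _)  _  = refl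

𝟙-cong : (a? : Dec A) (b? : Dec B) → (A → B) → (B → A) → 𝟙 a? ≡ 𝟙 b?
𝟙-cong a? (yes b) _ from = 𝟙-yes a? (from b)
𝟙-cong a? (no ¬b) to _   = 𝟙-no a? (¬b ∘ to)

𝟙-idem : (a? : Dec A) → 𝟙 a? * 𝟙 a? ≡ 𝟙 a?
𝟙-idem (yes _) = refl
𝟙-idem (no _)  = refl

∣p∣≡∑𝟙∈ : ∀ {n} (p : Subset n) → ∣ p ∣ ≡ ∑[ i < n ] 𝟙 (i ∈? p)
∣p∣≡∑𝟙∈ []            = refl
∣p∣≡∑𝟙∈ (inside  ∷ p) = cong suc (∣p∣≡∑𝟙∈ p)
∣p∣≡∑𝟙∈ (outside ∷ p) = ∣p∣≡∑𝟙∈ p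

module _ {P : Pred A p} (P? : Decidable P) where

  length-filter-tabulate : ∀ {n} (f : Fin n → A) →
                           length (filter P? (tabulate f)) ≡ ∑[ i < n ] 𝟙 (P? (f i))
  length-filter-tabulate {zero}  f = refl
  length-filter-tabulate {suc n} f with does (P? (f zero))
  ... | true  = cong suc (length-filter-tabulate (f ∘ suc))
  ... | false = length-filter-tabulate (f ∘ suc)

length-filter-cartesianProduct :
  ∀ {m n} {P : Pred (A × B) p} (P? : Decidable P) (f : Fin m → A) (g : Fin n → B) →
  length (filter P? (cartesianProduct (tabulate f) (tabulate g))) ≡
  ∑[ i < m ] ∑[ j < n ] 𝟙 (P? (f i , g j))
length-filter-cartesianProduct {m = zero}  P? f g = refl
length-filter-cartesianProduct {m = suc m} {n} P? f g = begin
  length (filter P? (row ++ rest))                ≡⟨ cong length (filter-++ P? row rest) ⟩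
  length (filter P? row ++ filter P? rest)        ≡⟨ length-++ (filter P? row) ⟩
  length (filter P? row) + length (filter P? rest)
    ≡⟨ cong₂ _+_ (trans (cong (length ∘ filter P?) (map-tabulate g (f zero ,_)))
                        (length-filter-tabulate P? ((f zero ,_) ∘ g)))
                 (length-filter-cartesianProduct P? (f ∘ suc) g) ⟩
  ∑[ j < n ] 𝟙 (P? (f zero , g j)) + ∑[ i < m ] ∑[ j < n ] 𝟙 (P? (f (suc i) , g j)) ∎
  where
  open ≡-Reasoning
  row  = mapᴸ (f zero ,_) (tabulate g)
  rest = cartesianProduct (tabulate (f ∘ suc)) (tabulate g)

∑-const : ∀ n c → ∑[ i < n ] c ≡ n * c
∑-const zero    c = refl
∑-const (suc n) c = cong (c +_) (∑-const n c)

∑-agree-off : ∀ {n} (f g : Fin n → ℕ) (i : Fin n) → (∀ j → j ≢ i → f j ≡ g j) →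
              ∑[ j < n ] f j + g i ≡ ∑[ j < n ] g j + f i
∑-agree-off {suc n} f g i agree = begin
  sum f + g i                                     ≡⟨ cong (_+ g i) (sum-remove f) ⟩
  f i + sum (f ∘ punchIn i) + g i
    ≡⟨ cong (λ s → f i + s + g i) (sum-cong-≗ (λ j → agree _ (punchInᵢ≢i i j))) ⟩
  f i + sum (g ∘ punchIn i) + g i                 ≡⟨ swap-outer (f i) _ (g i) ⟩
  g i + sum (g ∘ punchIn i) + f i                 ≡⟨ cong (_+ f i) (sym (sum-remove g)) ⟩
  sum g + f i                                     ∎
  where
  open ≡-Reasoning
  swap-outer : ∀ x s y → x + s + y ≡ y + s + x
  swap-outer = solve-∀

∑-𝟙≟ : ∀ {n} (i : Fin n) → ∑[ j < n ] 𝟙 (i ≟ j) ≡ 1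
∑-𝟙≟ {n} i = begin
  ∑[ j < n ] 𝟙 (i ≟ j)     ≡⟨ sym (+-identityʳ _) ⟩
  ∑[ j < n ] 𝟙 (i ≟ j) + 0 ≡⟨ ∑-agree-off (λ j → 𝟙 (i ≟ j)) (λ _ → 0) i
                                 (λ j j≢i → 𝟙-no (i ≟ j) (j≢i ∘ sym)) ⟩
  ∑[ j < n ] 0 + 𝟙 (i ≟ i) ≡⟨ cong₂ _+_ (sum-replicate-zero n) (𝟙-yes (i ≟ i) refl) ⟩
  1                        ∎
  where open ≡-Reasoning

module _ {n} {_∙_ : Op₂ (Fin n)} {ε : Fin n} {_⁻¹ : Op₁ (Fin n)}
         (isGroup : IsGroup _≡_ _∙_ ε _⁻¹) (T : Subset n) where

  private
    group : Group _ _
    group = record { isGroup = isGroup }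
  open GroupProperties group using (⁻¹-involutive; ⁻¹-anti-homo-//; x∙y⁻¹≈ε⇒x≈y; ε⁻¹≈ε)
  open ≡-Reasoning

  Δ : Fin n → ℕ
  Δ = diffCount _∙_ ε _⁻¹ T

  Δ≡∑∑ : ∀ g → Δ g ≡ ∑[ x < n ] ∑[ y < n ] 𝟙 (diffPair? _∙_ ε _⁻¹ T g (x , y))
  Δ≡∑∑ g = length-filter-cartesianProduct (diffPair? _∙_ ε _⁻¹ T g) id id

  diffPair-swap : ∀ {g x y} → x ∈ T × y ∈ T × x ≢ y × x ∙ (y ⁻¹) ≡ g →
                  y ∈ T × x ∈ T × y ≢ x × y ∙ (x ⁻¹) ≡ g ⁻¹
  diffPair-swap {x = x} {y} (x∈T , y∈T , x≢y , xy⁻¹≡g) =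
    y∈T , x∈T , x≢y ∘ sym , trans (sym (⁻¹-anti-homo-// x y)) (cong _⁻¹ xy⁻¹≡g)

  Δ-⁻¹ : ∀ g → Δ (g ⁻¹) ≡ Δ g
  Δ-⁻¹ g = begin
    Δ (g ⁻¹)                                                ≡⟨ Δ≡∑∑ (g ⁻¹) ⟩
    ∑[ x < n ] ∑[ y < n ] 𝟙 (diffPair? _∙_ ε _⁻¹ T (g ⁻¹) (x , y))
      ≡⟨ ∑-comm (λ x y → 𝟙 (diffPair? _∙_ ε _⁻¹ T (g ⁻¹) (x , y))) ⟩
    ∑[ y < n ] ∑[ x < n ] 𝟙 (diffPair? _∙_ ε _⁻¹ T (g ⁻¹) (x , y))
      ≡⟨ sum-cong-≗ (λ y → sum-cong-≗ (λ x →
           𝟙-cong (diffPair? _∙_ ε _⁻¹ T (g ⁻¹) (x , y)) (diffPair? _∙_ ε _⁻¹ T g (y , x))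
                  (unswap ∘ diffPair-swap) diffPair-swap)) ⟩
    ∑[ y < n ] ∑[ x < n ] 𝟙 (diffPair? _∙_ ε _⁻¹ T g (y , x)) ≡⟨ Δ≡∑∑ g ⟨
    Δ g                                                     ∎
    where
    unswap : ∀ {x y} → y ∈ T × x ∈ T × y ≢ x × y ∙ (x ⁻¹) ≡ g ⁻¹ ⁻¹ →
             y ∈ T × x ∈ T × y ≢ x × y ∙ (x ⁻¹) ≡ g
    unswap (y∈T , x∈T , y≢x , e) = y∈T , x∈T , y≢x , trans e (⁻¹-involutive g)

  Δ-ε : Δ ε ≡ 0
  Δ-ε = begin
    Δ ε                                                   ≡⟨ Δ≡∑∑ ε ⟩
    ∑[ x < n ] ∑[ y < n ] 𝟙 (diffPair? _∙_ ε _⁻¹ T ε (x , y))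
      ≡⟨ sum-cong-≗ (λ x → sum-cong-≗ (λ y → 𝟙-no (diffPair? _∙_ ε _⁻¹ T ε (x , y))
            (λ (_ , _ , x≢y , xy⁻¹≡ε) → x≢y (x∙y⁻¹≈ε⇒x≈y x y xy⁻¹≡ε)))) ⟩
    ∑[ x < n ] ∑[ y < n ] 0                               ≡⟨ sum-cong-≗ {n} (λ _ → sum-replicate-zero n) ⟩
    ∑[ x < n ] 0                                          ≡⟨ sum-replicate-zero n ⟩
    0                                                     ∎

  ∑-diffPair : ∀ x y → ∑[ g < n ] 𝟙 (diffPair? _∙_ ε _⁻¹ T g (x , y)) ≡
                       𝟙 (x ∈? T) * (𝟙 (y ∈? T) * 𝟙 (¬? (x ≟ y)))
  ∑-diffPair x y with x ∈? T | y ∈? T | x ≟ y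
  ... | yes _ | yes _ | no _  = ∑-𝟙≟ (x ∙ (y ⁻¹))
  ... | yes _ | yes _ | yes _ = sum-replicate-zero n
  ... | yes _ | no _  | _     = sum-replicate-zero n
  ... | no _  | _     | _     = sum-replicate-zero n

  ∣T∖⁅_⁆∣ : Fin n → ℕ
  ∣T∖⁅ x ⁆∣ = ∑[ y < n ] (𝟙 (y ∈? T) * 𝟙 (¬? (x ≟ y)))

  ∣T∖⁅x⁆∣+𝟙∈ : ∀ x → ∣T∖⁅ x ⁆∣ + 𝟙 (x ∈? T) ≡ ∣ T ∣
  ∣T∖⁅x⁆∣+𝟙∈ x = begin
    ∣T∖⁅ x ⁆∣ + 𝟙 (x ∈? T)
      ≡⟨ ∑-agree-off (λ y → 𝟙 (y ∈? T) * 𝟙 (¬? (x ≟ y))) (λ y → 𝟙 (y ∈? T)) x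
           (λ y y≢x → trans (cong (𝟙 (y ∈? T) *_) (𝟙-yes (¬? (x ≟ y)) (y≢x ∘ sym)))
                            (*-identityʳ _)) ⟩
    ∑[ y < n ] 𝟙 (y ∈? T) + 𝟙 (x ∈? T) * 𝟙 (¬? (x ≟ x))
      ≡⟨ cong (λ z → ∑[ y < n ] 𝟙 (y ∈? T) + 𝟙 (x ∈? T) * z)
              (𝟙-no (¬? (x ≟ x)) (λ x≢x → x≢x refl)) ⟩
    ∑[ y < n ] 𝟙 (y ∈? T) + 𝟙 (x ∈? T) * 0 ≡⟨ cong (∑[ y < n ] 𝟙 (y ∈? T) +_) (*-zeroʳ (𝟙 (x ∈? T))) ⟩
    ∑[ y < n ] 𝟙 (y ∈? T) + 0              ≡⟨ +-identityʳ _ ⟩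
    ∑[ y < n ] 𝟙 (y ∈? T)                  ≡⟨ ∣p∣≡∑𝟙∈ T ⟨
    ∣ T ∣                                  ∎

  ∑Δ≡∑∣T∖⁅x⁆∣ : ∑[ g < n ] Δ g ≡ ∑[ x < n ] (𝟙 (x ∈? T) * ∣T∖⁅ x ⁆∣)
  ∑Δ≡∑∣T∖⁅x⁆∣ = begin
    ∑[ g < n ] Δ g                                                     ≡⟨ sum-cong-≗ Δ≡∑∑ ⟩
    ∑[ g < n ] ∑[ x < n ] ∑[ y < n ] 𝟙 (diffPair? _∙_ ε _⁻¹ T g (x , y))
      ≡⟨ ∑-comm (λ g x → ∑[ y < n ] 𝟙 (diffPair? _∙_ ε _⁻¹ T g (x , y))) ⟩
    ∑[ x < n ] ∑[ g < n ] ∑[ y < n ] 𝟙 (diffPair? _∙_ ε _⁻¹ T g (x , y))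
      ≡⟨ sum-cong-≗ (λ x → ∑-comm (λ g y → 𝟙 (diffPair? _∙_ ε _⁻¹ T g (x , y)))) ⟩
    ∑[ x < n ] ∑[ y < n ] ∑[ g < n ] 𝟙 (diffPair? _∙_ ε _⁻¹ T g (x , y))
      ≡⟨ sum-cong-≗ (λ x → sum-cong-≗ (∑-diffPair x)) ⟩
    ∑[ x < n ] ∑[ y < n ] (𝟙 (x ∈? T) * (𝟙 (y ∈? T) * 𝟙 (¬? (x ≟ y))))
      ≡⟨ sum-cong-≗ (λ x → *-distribˡ-sum (𝟙 (x ∈? T)) (λ y → 𝟙 (y ∈? T) * 𝟙 (¬? (x ≟ y)))) ⟨
    ∑[ x < n ] (𝟙 (x ∈? T) * ∣T∖⁅ x ⁆∣)                                ∎

  ∑Δ+∣T∣≡∣T∣*∣T∣ : ∑[ g < n ] Δ g + ∣ T ∣ ≡ ∣ T ∣ * ∣ T ∣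
  ∑Δ+∣T∣≡∣T∣*∣T∣ = begin
    ∑[ g < n ] Δ g + ∣ T ∣
      ≡⟨ cong₂ _+_ ∑Δ≡∑∣T∖⁅x⁆∣ (trans (∣p∣≡∑𝟙∈ T) (sum-cong-≗ (λ x → sym (𝟙-idem (x ∈? T))))) ⟩
    ∑[ x < n ] (𝟙 (x ∈? T) * ∣T∖⁅ x ⁆∣) + ∑[ x < n ] (𝟙 (x ∈? T) * 𝟙 (x ∈? T))
      ≡⟨ ∑-distrib-+ (λ x → 𝟙 (x ∈? T) * ∣T∖⁅ x ⁆∣) (λ x → 𝟙 (x ∈? T) * 𝟙 (x ∈? T)) ⟨
    ∑[ x < n ] (𝟙 (x ∈? T) * ∣T∖⁅ x ⁆∣ + 𝟙 (x ∈? T) * 𝟙 (x ∈? T))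
      ≡⟨ sum-cong-≗ (λ x → trans (sym (*-distribˡ-+ (𝟙 (x ∈? T)) _ _))
                                 (trans (cong (𝟙 (x ∈? T) *_) (∣T∖⁅x⁆∣+𝟙∈ x)) (*-comm _ ∣ T ∣))) ⟩
    ∑[ x < n ] (∣ T ∣ * 𝟙 (x ∈? T)) ≡⟨ *-distribˡ-sum ∣ T ∣ (λ x → 𝟙 (x ∈? T)) ⟨
    ∣ T ∣ * ∑[ x < n ] 𝟙 (x ∈? T)   ≡⟨ cong (∣ T ∣ *_) (∣p∣≡∑𝟙∈ T) ⟨
    ∣ T ∣ * ∣ T ∣                   ∎

  pds-⁻¹-closed : ∀ {k lam mu} → lam ≢ mu → IsPDS _∙_ ε _⁻¹ k lam mu T →
                  ∀ {g} → g ∈ T → g ⁻¹ ∈ T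
  pds-⁻¹-closed lam≢mu (_ , λ-count , μ-count) {g} g∈T with g ⁻¹ ∈? T | g ≟ ε
  ... | yes g⁻¹∈T | _        = g⁻¹∈T
  ... | no g⁻¹∉T  | yes refl = contradiction (subst (_∈ T) (sym ε⁻¹≈ε) g∈T) g⁻¹∉T
  ... | no g⁻¹∉T  | no g≢ε   = contradiction (begin
    _        ≡⟨ λ-count g g≢ε g∈T ⟨
    Δ g      ≡⟨ Δ-⁻¹ g ⟨
    Δ (g ⁻¹) ≡⟨ μ-count (g ⁻¹) g⁻¹≢ε g⁻¹∉T ⟩
    _        ∎) lam≢mu
    where
    g⁻¹≢ε : g ⁻¹ ≢ ε
    g⁻¹≢ε g⁻¹≡ε = g≢ε (trans (sym (⁻¹-involutive g)) (trans (cong _⁻¹ g⁻¹≡ε) ε⁻¹≈ε))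

  pds-reversible : ∀ {k lam mu} → lam ≢ mu → IsPDS _∙_ ε _⁻¹ k lam mu T →
                   Reversible _∙_ ε _⁻¹ T
  pds-reversible lam≢mu pds x = mk⇔ closed (subst (_∈ T) (⁻¹-involutive x) ∘ closed)
    where
    closed : ∀ {g} → g ∈ T → g ⁻¹ ∈ T
    closed = pds-⁻¹-closed lam≢mu pds

  -- k(k − 1) + (μ − λ)k = μ(v − 1) + (μ − λ)[ε ∈ T], with μ = λ + d and the subtractions
  -- moved across.
  pds-identity-count : ∀ {k lam d} → IsPDS _∙_ ε _⁻¹ k lam (lam + d) T →
                       k * k + d * k + (lam + d) ≡ k + n * (lam + d) + d * 𝟙 (ε ∈? T)
  pds-identity-count {k} {lam} {d} (∣T∣≡k , λ-count , μ-count) = begin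
    k * k + d * k + μ                   ≡⟨ cong (λ s → s + d * k + μ) ∑Δ+k≡k*k ⟨
    ∑[ g < n ] Δ g + k + d * k + μ      ≡⟨ shuffle (∑[ g < n ] Δ g) k (d * k) μ ⟩
    k + (∑[ g < n ] Δ g + d * k + μ)    ≡⟨ cong (λ s → k + (s + μ)) ∑h ⟨
    k + (∑[ g < n ] h g + μ)            ≡⟨ cong (k +_) (∑-agree-off h (λ _ → μ) ε h-off) ⟩
    k + (∑[ g < n ] μ + h ε)            ≡⟨ cong (λ s → k + (∑[ g < n ] μ + (s + d * 𝟙 (ε ∈? T)))) Δ-ε ⟩
    k + (∑[ g < n ] μ + d * 𝟙 (ε ∈? T)) ≡⟨ cong (λ s → k + (s + d * 𝟙 (ε ∈? T))) (∑-const n μ) ⟩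
    k + (n * μ + d * 𝟙 (ε ∈? T))        ≡⟨ +-assoc k _ _ ⟨
    k + n * μ + d * 𝟙 (ε ∈? T)          ∎
    where
    μ : ℕ
    μ = lam + d

    h : Fin n → ℕ
    h g = Δ g + d * 𝟙 (g ∈? T)

    h-off : ∀ g → g ≢ ε → h g ≡ μ
    h-off g g≢ε with g ∈? T
    ... | yes g∈T = cong₂ _+_ (λ-count g g≢ε g∈T) (*-identityʳ d)
    ... | no g∉T  = trans (cong₂ _+_ (μ-count g g≢ε g∉T) (*-zeroʳ d)) (+-identityʳ μ)

    ∑h : ∑[ g < n ] h g ≡ ∑[ g < n ] Δ g + d * k
    ∑h = begin
      ∑[ g < n ] h g                               ≡⟨ ∑-distrib-+ Δ (λ g → d * 𝟙 (g ∈? T)) ⟩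
      ∑[ g < n ] Δ g + ∑[ g < n ] (d * 𝟙 (g ∈? T))
        ≡⟨ cong (∑[ g < n ] Δ g +_) (*-distribˡ-sum d (λ g → 𝟙 (g ∈? T))) ⟨
      ∑[ g < n ] Δ g + d * ∑[ g < n ] 𝟙 (g ∈? T)
        ≡⟨ cong (λ s → ∑[ g < n ] Δ g + d * s) (trans (sym ∣T∣≡k) (∣p∣≡∑𝟙∈ T)) ⟨
      ∑[ g < n ] Δ g + d * k                       ∎

    ∑Δ+k≡k*k : ∑[ g < n ] Δ g + k ≡ k * k
    ∑Δ+k≡k*k = subst (λ m → ∑[ g < n ] Δ g + m ≡ m * m) ∣T∣≡k ∑Δ+∣T∣≡∣T∣*∣T∣

    shuffle : ∀ s k e m → s + k + e + m ≡ k + (s + e + m)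
    shuffle = solve-∀

mainTheorem5 : (_∙_ : Op₂ (Fin 96)) (ε : Fin 96) (_⁻¹ : Op₁ (Fin 96)) →
               IsGroup _≡_ _∙_ ε _⁻¹ →
               (T : Subset 96) →
               IsPDS _∙_ ε _⁻¹ 19 2 4 T →
               Regular _∙_ ε _⁻¹ T
mainTheorem5 _∙_ ε _⁻¹ isGroup T pds = pds-reversible isGroup T (λ ()) pds , ε∉T
  where
  ε∉T : ε ∉ T
  ε∉T ε∈T = contradiction
    (trans (pds-identity-count isGroup T {d = 2} pds)
           (cong (λ z → 19 + 96 * 4 + 2 * z) (𝟙-yes (ε ∈? T) ε∈T)))
    (λ ())
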